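{- Let $M=(E,\mathcal I)$ be a matroid with rank function $\mathrm{rank}$ and rank $r=\mathrm{rank}(E)$, let $u:E\to\mathbb Z_{\ge 0}$ be integer capacities, and let $k\ge 1$ be an integer. Suppose bases $B_1,\dots,B_k$ (with insertion-level partitions $B_i=\bigsqcup_{j\ge0}B_{i,j}$) and levels $\ell:E\to\mathbb Z_{\ge 0}$ satisfy the push-relabel invariants (I1)–(I3) with height parameter $h>r+2$. Then there exists a level $j$ such that $$\sum_{e\in E}\min\{u(e),x(e)\}\ \ge\ u(L_{<j})+k\,\mathrm{rank}(L_{\ge j}).$$ Consequently $B_1,\dots,B_k$ is an optimal solution of the $k$-fold matroid union problem and $L_{\ge j}$ is an optimal solution of its dual.
   Context: For a set $S\subseteq E$, $u(S)=\sum_{e\in S}u(e)$; $\mathrm{span}(S)=\{e:\mathrm{rank}(S+e)=\mathrm{rank}(S)\}$, and "$S$ spans $T$" means $T\subseteq\mathrm{span}(S)$. Given bases $B_1,\dots,B_k$ of $M$ (not necessarily distinct), $x(e)=|\{i\in[k]:e\in B_i\}|$; $e$ is uncovered if $x(e)<u(e)$, covered if $x(e)\ge u(e)$, overpacked if $x(e)>u(e)$. Levels: $L_j=\{e:\ell(e)=j\}$, and $L_{<j},L_{\le j},L_{>j},L_{\ge j}$ are defined analogously. Each base $B_i$ is partitioned into sets $B_{i,j}$ ($j\ge 0$), where $B_{i,j}$ is the set of elements of $B_i$ that were inserted into $B_i$ while at level $j$; since levels never decrease, every $e\in B_{i,j}$ has $\ell(e)\ge j$. Write $B_{i,\ge j}=\bigcup_{j'\ge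 j}B_{i,j'}$ (similarly $B_{i,>j}$ etc.). The push-relabel invariants with height parameter $h$ are: (I1) every $e$ with $x(e)>u(e)$ has $\ell(e)=0$; (I2) for every $i\in[k]$ and every level $j$, $B_{i,\ge j}$ spans $L_{>j}$; (I3) every uncovered element $e$ has $\ell(e)\ge h$. The $k$-fold matroid union problem is to maximize $\sum_{e}\min\{u(e),x(e)\}$ over $k$ bases $B_1,\dots,B_k$; its dual is to minimize $k\,\mathrm{rank}(S)+u(E\setminus S)$ over $S\subseteq E$; the two optima are equal. -}

module Defs where

open import Data.Nat using (ℕ; zero; suc; _+_; _*_; _≤_; _<_; _⊓_; _≤ᵇ_; _<ᵇ_)
open import Data.Bool using (Bool; true; false; _∧_; if_then_else_)
open import Data.Fin using (Fin)
open import Data.Fin.Subset using (Subset; _∪_; _∩_; _⊆_; ∣_∣; ⁅_⁆; ⊤; _∈_; ∁)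
open import Data.Vec using (Vec; lookup; tabulate; sum)
open import Data.Product using (Σ; ∃; _×_; _,_)
open import Relation.Binary.PropositionalEquality using (_≡_)

record Matroid (n : ℕ) : Set where
  field
    rank        : Subset n → ℕ
    rank-bound  : ∀ S → rank S ≤ ∣ S ∣
    rank-mono   : ∀ {S T} → S ⊆ T → rank S ≤ rank T
    rank-submod : ∀ S T → rank (S ∪ T) + rank (S ∩ T) ≤ rank S + rank T

module _ {n : ℕ} (M : Matroid n) where
  open Matroid M

  fullRank : ℕ
  fullRank = rank ⊤

  IsBasis : Subset n → Set
  IsBasis B = (rank B ≡ ∣ B ∣) × (∣ B ∣ ≡ rank ⊤)

  InSpan : Subset n → Fin n → Set
  InSpan S e = rank (S ∪ ⁅ e ⁆) ≡ rank S

  Spans : Subset n → Subset n → Set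
  Spans S T = ∀ e → e ∈ T → InSpan S e

weight : {n : ℕ} → (Fin n → ℕ) → Subset n → ℕ
weight u S = sum (tabulate (λ e → if lookup S e then u e else 0))

load : {n k : ℕ} → (Fin k → Subset n) → Fin n → ℕ
load B e = ∣ tabulate (λ i → lookup (B i) e) ∣

value : {n k : ℕ} → (Fin n → ℕ) → (Fin k → Subset n) → ℕ
value u B = sum (tabulate (λ e → u e ⊓ load B e))

Lless : {n : ℕ} → (Fin n → ℕ) → ℕ → Subset n
Lless ℓ j = tabulate (λ e → suc (ℓ e) ≤ᵇ j)

Lgt : {n : ℕ} → (Fin n → ℕ) → ℕ → Subset n
Lgt ℓ j = tabulate (λ e → j <ᵇ ℓ e)

Lgeq : {n : ℕ} → (Fin n → ℕ) → ℕ → Subset n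
Lgeq ℓ j = tabulate (λ e → j ≤ᵇ ℓ e)

-- The insertion-level partition B_i = ⊔_j B_{i,j} is represented by the
-- map ins i : B_i → ℕ sending e to the unique j with e ∈ B_{i,j}
-- (values outside B_i are irrelevant).  B_{i,≥j}:
Bgeq : {n k : ℕ} → (Fin k → Subset n) → (Fin k → Fin n → ℕ) → Fin k → ℕ → Subset n
Bgeq B ins i j = tabulate (λ e → lookup (B i) e ∧ (j ≤ᵇ ins i e))

record PushRelabelState {n k : ℕ} (M : Matroid n) (u : Fin n → ℕ) (h : ℕ)
         (B : Fin k → Subset n) (ins : Fin k → Fin n → ℕ) (ℓ : Fin n → ℕ) : Set where
  field
    bases     : ∀ i → IsBasis M (B i)
    ins-level : ∀ i e → e ∈ B i → ins i e ≤ ℓ e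
    I1        : ∀ e → u e < load B e → ℓ e ≡ 0
    I2        : ∀ i j → Spans M (Bgeq B ins i j) (Lgt ℓ j)
    I3        : ∀ e → load B e < u e → h ≤ ℓ e

{-# OPTIONS --safe #-}
module Submission where

-- Every rank(L_{>m}) is at most r, so m ↦ rank(L_{>m}) cannot strictly decrease r + 1 times
-- in a row: some level j = m + 1 ≤ r + 1 < h has rank(L_{≥j}) = rank(L_{>m}) ≤ rank(L_{>j}).
-- By (I2) every B_i then has at least rank(L_{≥j}) elements in L_{≥j}; those are not
-- overpacked by (I1), and the elements below j < h are covered by (I3).  Summing,
-- the value of B_1, …, B_k is at least the dual objective k rank(L_{≥j}) + u(L_{<j}).
-- Weak duality (an independent set meets S in at most rank(S) elements) gives both
-- optimality claims.

open import Defs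
open import Data.Nat using (ℕ; _+_; _*_; _≤_; _<_; suc)
open import Data.Fin using (Fin)
open import Data.Fin.Subset using (Subset; ∁)
open import Data.Product using (∃; _×_)

open import Data.Nat.Properties
open import Algebra.Properties.CommutativeMonoid.Sum +-0-commutativeMonoid
  using (sum-syntax; ∑-comm; ∑-distrib-+; sum-cong-≗; sum-replicate-zero)
open import Data.Bool using (Bool; true; false; not; _∧_; T; if_then_else_)
open import Data.Bool.Properties using (T-≡; T-∧)
open import Data.Fin using (zero; suc)
open import Data.Fin.Subset using (_∪_; _∩_; _⊆_; _∈_; _∉_; ∣_∣; ⁅_⁆)
open import Data.Fin.Subset.Properties
  using (_∈?_; ⊆⊤; x∈⁅x⁆; p⊆p∪q; q⊆p∪q; x∈p∪q⁺; x∈p∪q⁻; x∈p∩q⁺; p∩q⊆q; x∉p⇒x∈∁p; p⊆q⇒∣p∣≤∣q∣)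
open import Data.List using (List; []; _∷_; filter; allFin)
open import Data.List.Membership.Propositional.Properties using (∈-filter⁺; ∈-allFin)
open import Data.List.Relation.Unary.All as All using (All; []; _∷_)
open import Data.List.Relation.Unary.All.Properties using (all-filter)
open import Data.List.Relation.Unary.Any using (here; there)
import Data.List.Membership.Propositional as List
open import Data.Nat using (zero; z≤n; s≤s; z<s; _⊓_; _≤ᵇ_; _<ᵇ_; _≤?_)
open import Data.Product using (_,_; proj₁)
open import Data.Sum using (inj₁; inj₂)
open import Data.Vec using ([]; _∷_; lookup; tabulate; sum)
open import Data.Vec.Properties using (lookup∘tabulate; lookup-map; lookup-zipWith; tabulate-∘; tabulate-cong; []=⇒lookup; lookup⇒[]=)
open import Function using (_∘_; Equivalence)
open import Relation.Binary.PropositionalEquality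
open import Relation.Nullary using (yes; no; contradiction)

open Equivalence using (to; from)

sum-tabulate : ∀ {n} (f : Fin n → ℕ) → sum (tabulate f) ≡ ∑[ i < n ] f i
sum-tabulate {zero}  f = refl
sum-tabulate {suc n} f = cong (f zero +_) (sum-tabulate (f ∘ suc))

∑-mono-≤ : ∀ {n} {f g : Fin n → ℕ} → (∀ i → f i ≤ g i) → ∑[ i < n ] f i ≤ ∑[ i < n ] g i
∑-mono-≤ {zero}  f≤g = z≤n
∑-mono-≤ {suc n} f≤g = +-mono-≤ (f≤g zero) (∑-mono-≤ (f≤g ∘ suc))

∑-const : ∀ n c → ∑[ i < n ] c ≡ n * c
∑-const zero    c = refl
∑-const (suc n) c = cong (c +_) (∑-const n c)

not-≤ᵇ : ∀ m n → not (m ≤ᵇ n) ≡ (n <ᵇ m)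
not-≤ᵇ zero          n       = refl
not-≤ᵇ (suc m)       zero    = refl
not-≤ᵇ (suc zero)    (suc n) = refl
not-≤ᵇ (suc (suc m)) (suc n) = not-≤ᵇ (suc m) n

∈-tabulate⁺ : ∀ {n} {f : Fin n → Bool} {x} → T (f x) → x ∈ tabulate f
∈-tabulate⁺ {f = f} {x} fx = lookup⇒[]= x (tabulate f) (trans (lookup∘tabulate f x) (to T-≡ fx))

∈-tabulate⁻ : ∀ {n} {f : Fin n → Bool} {x} → x ∈ tabulate f → T (f x)
∈-tabulate⁻ {f = f} {x} x∈ = from T-≡ (trans (sym (lookup∘tabulate f x)) ([]=⇒lookup x∈))

module _ {n : ℕ} (ℓ : Fin n → ℕ) where

  ∈Lgeq⇒ : ∀ {j e} → e ∈ Lgeq ℓ j → j ≤ ℓ e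
  ∈Lgeq⇒ {j} {e} e∈ = ≤ᵇ⇒≤ j (ℓ e) (∈-tabulate⁻ e∈)

  ∉Lgeq⇒ : ∀ {j e} → e ∉ Lgeq ℓ j → ℓ e < j
  ∉Lgeq⇒ e∉ = ≰⇒> (e∉ ∘ ∈-tabulate⁺ ∘ ≤⇒≤ᵇ)

  Lless≡∁Lgeq : ∀ j → Lless ℓ j ≡ ∁ (Lgeq ℓ j)
  Lless≡∁Lgeq j = trans (tabulate-cong (λ e → sym (not-≤ᵇ j (ℓ e)))) (tabulate-∘ not (λ e → j ≤ᵇ ℓ e))

∣p∣≡∣p∩q∣+∣p∩∁q∣ : ∀ {n} (p q : Subset n) → ∣ p ∣ ≡ ∣ p ∩ q ∣ + ∣ p ∩ ∁ q ∣
∣p∣≡∣p∩q∣+∣p∩∁q∣ []          []          = refl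
∣p∣≡∣p∩q∣+∣p∩∁q∣ (true ∷ p)  (true ∷ q)  = cong suc (∣p∣≡∣p∩q∣+∣p∩∁q∣ p q)
∣p∣≡∣p∩q∣+∣p∩∁q∣ (true ∷ p)  (false ∷ q) =
  trans (cong suc (∣p∣≡∣p∩q∣+∣p∩∁q∣ p q)) (sym (+-suc ∣ p ∩ q ∣ ∣ p ∩ ∁ q ∣))
∣p∣≡∣p∩q∣+∣p∩∁q∣ (false ∷ p) (_ ∷ q)     = ∣p∣≡∣p∩q∣+∣p∩∁q∣ p q

p⊆p∩q∪p∩∁q : ∀ {n} (p q : Subset n) → p ⊆ (p ∩ q) ∪ (p ∩ ∁ q)
p⊆p∩q∪p∩∁q p q {x} x∈p with x ∈? q
... | yes x∈q = x∈p∪q⁺ (inj₁ (x∈p∩q⁺ (x∈p , x∈q)))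
... | no  x∉q = x∈p∪q⁺ (inj₂ (x∈p∩q⁺ (x∈p , x∉p⇒x∈∁p x∉q)))

masked : ∀ {n} → Subset n → (Fin n → ℕ) → Fin n → ℕ
masked S f e = if lookup S e then f e else 0

χ : ∀ {n} → Subset n → Fin n → ℕ
χ p = masked p (λ _ → 1)

∣p∣≡∑χ : ∀ {n} (p : Subset n) → ∣ p ∣ ≡ ∑[ e < n ] χ p e
∣p∣≡∑χ []          = refl
∣p∣≡∑χ (true ∷ p)  = cong suc (∣p∣≡∑χ p)
∣p∣≡∑χ (false ∷ p) = ∣p∣≡∑χ p

χ-∩ : ∀ {n} (p q : Subset n) e → masked q (χ p) e ≡ χ (p ∩ q) e
χ-∩ p q e rewrite lookup-zipWith _∧_ e p q with lookup p e | lookup q e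
... | true  | true  = refl
... | true  | false = refl
... | false | true  = refl
... | false | false = refl

masked-∑ : ∀ {n k} S (f : Fin k → Fin n → ℕ) e →
  masked S (λ e → ∑[ i < k ] f i e) e ≡ ∑[ i < k ] masked S (f i) e
masked-∑ {k = k} S f e with lookup S e
... | true  = refl
... | false = sym (sum-replicate-zero k)

load≡∑χ : ∀ {n k} (B : Fin k → Subset n) e → load B e ≡ ∑[ i < k ] χ (B i) e
load≡∑χ B e = trans (∣p∣≡∑χ (tabulate λ i → lookup (B i) e))
  (sum-cong-≗ λ i → cong (λ b → if b then 1 else 0) (lookup∘tabulate (λ i → lookup (B i) e) i))

∑-masked-load : ∀ {n k} (B : Fin k → Subset n) S →
  ∑[ e < n ] masked S (load B) e ≡ ∑[ i < k ] ∣ B i ∩ S ∣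
∑-masked-load {n} {k} B S = begin
  ∑[ e < n ] masked S (load B) e                     ≡⟨ sum-cong-≗ (λ e → cong (λ x → if lookup S e then x else 0) (load≡∑χ B e)) ⟩
  ∑[ e < n ] masked S (λ e → ∑[ i < k ] χ (B i) e) e ≡⟨ sum-cong-≗ (masked-∑ S (χ ∘ B)) ⟩
  ∑[ e < n ] ∑[ i < k ] masked S (χ (B i)) e         ≡⟨ sum-cong-≗ (λ e → sum-cong-≗ λ i → χ-∩ (B i) S e) ⟩
  ∑[ e < n ] ∑[ i < k ] χ (B i ∩ S) e                ≡⟨ ∑-comm (λ e i → χ (B i ∩ S) e) ⟩
  ∑[ i < k ] ∑[ e < n ] χ (B i ∩ S) e                ≡⟨ sum-cong-≗ (λ i → sym (∣p∣≡∑χ (B i ∩ S))) ⟩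
  ∑[ i < k ] ∣ B i ∩ S ∣                             ∎
  where open ≡-Reasoning

insertAll : ∀ {n} → List (Fin n) → Subset n → Subset n
insertAll []       S = S
insertAll (e ∷ es) S = insertAll es S ∪ ⁅ e ⁆

⊆-insertAll : ∀ {n} (es : List (Fin n)) {S} → S ⊆ insertAll es S
⊆-insertAll []       x∈S = x∈S
⊆-insertAll (e ∷ es) x∈S = p⊆p∪q ⁅ e ⁆ (⊆-insertAll es x∈S)

∈-insertAll : ∀ {n} {es : List (Fin n)} {S x} → x List.∈ es → x ∈ insertAll es S
∈-insertAll {es = e ∷ es} (here refl) = q⊆p∪q (insertAll es _) ⁅ e ⁆ (x∈⁅x⁆ e)
∈-insertAll {es = e ∷ es} (there x∈es) = p⊆p∪q ⁅ e ⁆ (∈-insertAll x∈es)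

module _ {n : ℕ} (M : Matroid n) where
  open Matroid M

  rank-∪-≤ : ∀ S T → rank (S ∪ T) ≤ rank S + rank T
  rank-∪-≤ S T = m+n≤o⇒m≤o (rank (S ∪ T)) (rank-submod S T)

  independent-∩-≤-rank : ∀ {B} → rank B ≡ ∣ B ∣ → ∀ S → ∣ B ∩ S ∣ ≤ rank S
  independent-∩-≤-rank {B} B-indep S = +-cancelʳ-≤ ∣ B ∩ ∁ S ∣ ∣ B ∩ S ∣ (rank S) (begin
    ∣ B ∩ S ∣ + ∣ B ∩ ∁ S ∣             ≡⟨ ∣p∣≡∣p∩q∣+∣p∩∁q∣ B S ⟨
    ∣ B ∣                               ≡⟨ B-indep ⟨
    rank B                              ≤⟨ rank-mono (p⊆p∩q∪p∩∁q B S) ⟩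
    rank ((B ∩ S) ∪ (B ∩ ∁ S))          ≤⟨ rank-∪-≤ (B ∩ S) (B ∩ ∁ S) ⟩
    rank (B ∩ S) + rank (B ∩ ∁ S)       ≤⟨ +-mono-≤ (rank-mono (p∩q⊆q B S)) (rank-bound (B ∩ ∁ S)) ⟩
    rank S + ∣ B ∩ ∁ S ∣                ∎)
    where open ≤-Reasoning

  InSpan-mono : ∀ {S X e} → S ⊆ X → InSpan M S e → InSpan M X e
  InSpan-mono {S} {X} {e} S⊆X e∈spanS =
    ≤-antisym (+-cancelʳ-≤ (rank S) (rank (X ∪ ⁅ e ⁆)) (rank X) (begin
      rank (X ∪ ⁅ e ⁆) + rank S                       ≤⟨ +-mono-≤ (rank-mono X+e⊆) (rank-mono S⊆) ⟩
      rank (X ∪ (S ∪ ⁅ e ⁆)) + rank (X ∩ (S ∪ ⁅ e ⁆)) ≤⟨ rank-submod X (S ∪ ⁅ e ⁆) ⟩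
      rank X + rank (S ∪ ⁅ e ⁆)                        ≡⟨ cong (rank X +_) e∈spanS ⟩
      rank X + rank S                                  ∎))
    (rank-mono (p⊆p∪q ⁅ e ⁆))
    where
    open ≤-Reasoning
    X+e⊆ : X ∪ ⁅ e ⁆ ⊆ X ∪ (S ∪ ⁅ e ⁆)
    X+e⊆ x∈ with x∈p∪q⁻ X ⁅ e ⁆ x∈
    ... | inj₁ x∈X = p⊆p∪q (S ∪ ⁅ e ⁆) x∈X
    ... | inj₂ x∈⁅e⁆ = q⊆p∪q X (S ∪ ⁅ e ⁆) (q⊆p∪q S ⁅ e ⁆ x∈⁅e⁆)
    S⊆ : S ⊆ X ∩ (S ∪ ⁅ e ⁆)
    S⊆ x∈S = x∈p∩q⁺ (S⊆X x∈S , p⊆p∪q ⁅ e ⁆ x∈S)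

  rank-insertAll : ∀ {S} {es : List (Fin n)} → All (InSpan M S) es → rank (insertAll es S) ≡ rank S
  rank-insertAll []                         = refl
  rank-insertAll {es = e ∷ es} (e∈span ∷ span) =
    trans (InSpan-mono (⊆-insertAll es) e∈span) (rank-insertAll span)

  Spans⇒rank-≤ : ∀ {S T} → Spans M S T → rank T ≤ rank S
  Spans⇒rank-≤ {S} {T} S-spans-T = begin
    rank T                ≤⟨ rank-mono (λ x∈T → ∈-insertAll (∈-filter⁺ (_∈? T) (∈-allFin _) x∈T)) ⟩
    rank (insertAll es S) ≡⟨ rank-insertAll (All.map (S-spans-T _) (all-filter (_∈? T) (allFin n))) ⟩
    rank S                ∎
    where
    open ≤-Reasoning
    es : List (Fin n)
    es = filter (_∈? T) (allFin n)

module _ {n k : ℕ} (u : Fin n → ℕ) (B : Fin k → Subset n) where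

  ⊓-≤-masked : ∀ S e → u e ⊓ load B e ≤ masked S (load B) e + masked (∁ S) u e
  ⊓-≤-masked S e rewrite lookup-map e not S with lookup S e
  ... | true  = ≤-trans (m⊓n≤n (u e) (load B e)) (m≤m+n (load B e) 0)
  ... | false = m⊓n≤m (u e) (load B e)

  masked-≤-⊓ : ∀ L e → (e ∉ L → u e ≤ load B e) → (e ∈ L → load B e ≤ u e) →
    masked (∁ L) u e + masked L (load B) e ≤ u e ⊓ load B e
  masked-≤-⊓ L e covered not-overpacked rewrite lookup-map e not L with lookup L e in L[e]
  ... | true  = ≤-reflexive (sym (m≥n⇒m⊓n≡n (not-overpacked (lookup⇒[]= e L L[e]))))
  ... | false = ≤-reflexive (trans (+-identityʳ (u e)) (sym (m≤n⇒m⊓n≡m (covered e∉L))))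
    where
    e∉L : e ∉ L
    e∉L e∈L with trans (sym ([]=⇒lookup e∈L)) L[e]
    ... | ()

  weak-duality : ∀ (M : Matroid n) → (∀ i → Matroid.rank M (B i) ≡ ∣ B i ∣) → ∀ S →
    value u B ≤ k * Matroid.rank M S + weight u (∁ S)
  weak-duality M B-indep S = begin
    value u B                                                  ≡⟨ sum-tabulate (λ e → u e ⊓ load B e) ⟩
    ∑[ e < n ] (u e ⊓ load B e)                                ≤⟨ ∑-mono-≤ (⊓-≤-masked S) ⟩
    ∑[ e < n ] (masked S (load B) e + masked (∁ S) u e)        ≡⟨ ∑-distrib-+ (masked S (load B)) (masked (∁ S) u) ⟩
    ∑[ e < n ] masked S (load B) e + ∑[ e < n ] masked (∁ S) u e ≡⟨ cong₂ _+_ (∑-masked-load B S) (sym (sum-tabulate (masked (∁ S) u))) ⟩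
    ∑[ i < k ] ∣ B i ∩ S ∣ + weight u (∁ S)                    ≤⟨ +-monoˡ-≤ _ (∑-mono-≤ λ i → independent-∩-≤-rank M (B-indep i) S) ⟩
    ∑[ i < k ] rank S + weight u (∁ S)                         ≡⟨ cong (_+ weight u (∁ S)) (∑-const k (rank S)) ⟩
    k * rank S + weight u (∁ S)                                ∎
    where
    open ≤-Reasoning
    open Matroid M

  value-lower-bound : ∀ L → (∀ e → e ∉ L → u e ≤ load B e) → (∀ e → e ∈ L → load B e ≤ u e) →
    weight u (∁ L) + ∑[ i < k ] ∣ B i ∩ L ∣ ≤ value u B
  value-lower-bound L covered not-overpacked = begin
    weight u (∁ L) + ∑[ i < k ] ∣ B i ∩ L ∣                      ≡⟨ cong₂ _+_ (sum-tabulate (masked (∁ L) u)) (sym (∑-masked-load B L)) ⟩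
    ∑[ e < n ] masked (∁ L) u e + ∑[ e < n ] masked L (load B) e ≡⟨ ∑-distrib-+ (masked (∁ L) u) (masked L (load B)) ⟨
    ∑[ e < n ] (masked (∁ L) u e + masked L (load B) e)        ≤⟨ ∑-mono-≤ (λ e → masked-≤-⊓ L e (covered e) (not-overpacked e)) ⟩
    ∑[ e < n ] (u e ⊓ load B e)                                ≡⟨ sum-tabulate (λ e → u e ⊓ load B e) ⟨
    value u B                                                  ∎
    where open ≤-Reasoning

∃-ascent : ∀ (a : ℕ → ℕ) t → a 0 ≤ t → ∃ λ m → m ≤ t × a m ≤ a (suc m)
∃-ascent a t a₀≤t with a 0 ≤? a 1
∃-ascent a t       a₀≤t | yes a₀≤a₁ = 0 , z≤n , a₀≤a₁
∃-ascent a zero    a₀≤0 | no  a₀≰a₁ = contradiction (≤-trans a₀≤0 z≤n) a₀≰a₁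
∃-ascent a (suc t) a₀≤t | no  a₀≰a₁ with ∃-ascent (a ∘ suc) t (≤-pred (≤-trans (≰⇒> a₀≰a₁) a₀≤t))
... | m , m≤t , ascent = suc m , s≤s m≤t , ascent

module _ {n k : ℕ} {M : Matroid n} {u : Fin n → ℕ} {h : ℕ} {B : Fin k → Subset n}
         {ins : Fin k → Fin n → ℕ} {ℓ : Fin n → ℕ} (st : PushRelabelState M u h B ins ℓ) where
  open Matroid M
  open PushRelabelState st

  covered-below-height : ∀ {e} → ℓ e < h → u e ≤ load B e
  covered-below-height ℓe<h = ≮⇒≥ (λ x<u → <⇒≱ ℓe<h (I3 _ x<u))

  not-overpacked-above-0 : ∀ {e} → 0 < ℓ e → load B e ≤ u e
  not-overpacked-above-0 {e} 0<ℓe = ≮⇒≥ (λ u<x → <⇒≢ 0<ℓe (sym (I1 e u<x)))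

  Bgeq⊆B∩Lgeq : ∀ i j → Bgeq B ins i j ⊆ B i ∩ Lgeq ℓ j
  Bgeq⊆B∩Lgeq i j {e} e∈Bgeq with to T-∧ (∈-tabulate⁻ e∈Bgeq)
  ... | B[e] , j≤ins =
    x∈p∩q⁺ (e∈B , ∈-tabulate⁺ (≤⇒≤ᵇ (≤-trans (≤ᵇ⇒≤ j (ins i e) j≤ins) (ins-level i e e∈B))))
    where
    e∈B : e ∈ B i
    e∈B = lookup⇒[]= e (B i) (to T-≡ B[e])

  rank-Lgt≤∣B∩Lgeq∣ : ∀ i j → rank (Lgt ℓ j) ≤ ∣ B i ∩ Lgeq ℓ j ∣
  rank-Lgt≤∣B∩Lgeq∣ i j = begin
    rank (Lgt ℓ j)          ≤⟨ Spans⇒rank-≤ M (I2 i j) ⟩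
    rank (Bgeq B ins i j)   ≤⟨ rank-bound _ ⟩
    ∣ Bgeq B ins i j ∣      ≤⟨ p⊆q⇒∣p∣≤∣q∣ (Bgeq⊆B∩Lgeq i j) ⟩
    ∣ B i ∩ Lgeq ℓ j ∣      ∎
    where open ≤-Reasoning

  value-≥-at-level : ∀ {j} → 0 < j → j ≤ h →
    weight u (∁ (Lgeq ℓ j)) + ∑[ i < k ] ∣ B i ∩ Lgeq ℓ j ∣ ≤ value u B
  value-≥-at-level {j} 0<j j≤h = value-lower-bound u B (Lgeq ℓ j)
    (λ e e∉L → covered-below-height (<-≤-trans (∉Lgeq⇒ ℓ {j} e∉L) j≤h))
    (λ e e∈L → not-overpacked-above-0 (<-≤-trans 0<j (∈Lgeq⇒ ℓ {j} e∈L)))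

lemma3p1 : {n k : ℕ} (M : Matroid n) (u : Fin n → ℕ) (h : ℕ)
    (B : Fin k → Subset n) (ins : Fin k → Fin n → ℕ) (ℓ : Fin n → ℕ) →
    1 ≤ k → fullRank M + 2 < h → PushRelabelState M u h B ins ℓ →
    ∃ λ (j : ℕ) →
      (weight u (Lless ℓ j) + k * Matroid.rank M (Lgeq ℓ j) ≤ value u B)
      × (∀ (B′ : Fin k → Subset n) → (∀ i → IsBasis M (B′ i)) → value u B′ ≤ value u B)
      × (∀ (S : Subset n) →
           k * Matroid.rank M (Lgeq ℓ j) + weight u (∁ (Lgeq ℓ j))
             ≤ k * Matroid.rank M S + weight u (∁ S))
lemma3p1 {n} {k} M u h B ins ℓ _ r+2<h st
  with ∃-ascent (λ m → Matroid.rank M (Lgt ℓ m)) (fullRank M) (Matroid.rank-mono M ⊆⊤)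
... | m , m≤r , ascent = suc m , primal , optimal , dual-optimal
  where
  open Matroid M
  open PushRelabelState st using (bases)
  -- rank L is definitionally rank (Lgt ℓ m), which the ascent at m bounds by rank (Lgt ℓ (suc m)).
  L : Subset n
  L = Lgeq ℓ (suc m)

  level≤h : suc m ≤ h
  level≤h = <⇒≤ (<-trans (≤-trans (s≤s (s≤s m≤r)) (≤-reflexive (+-comm 2 (fullRank M)))) r+2<h)

  dual≤value : k * rank L + weight u (∁ L) ≤ value u B
  dual≤value = begin
    k * rank L + weight u (∁ L)             ≡⟨ +-comm (k * rank L) _ ⟩
    weight u (∁ L) + k * rank L             ≡⟨ cong (weight u (∁ L) +_) (∑-const k (rank L)) ⟨
    weight u (∁ L) + ∑[ i < k ] rank L      ≤⟨ +-monoʳ-≤ _ (∑-mono-≤ λ i → ≤-trans ascent (rank-Lgt≤∣B∩Lgeq∣ st i (suc m))) ⟩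
    weight u (∁ L) + ∑[ i < k ] ∣ B i ∩ L ∣ ≤⟨ value-≥-at-level st z<s level≤h ⟩
    value u B                               ∎
    where open ≤-Reasoning

  primal : weight u (Lless ℓ (suc m)) + k * rank L ≤ value u B
  primal rewrite Lless≡∁Lgeq ℓ (suc m) = ≤-trans (≤-reflexive (+-comm _ (k * rank L))) dual≤value

  optimal : ∀ B′ → (∀ i → IsBasis M (B′ i)) → value u B′ ≤ value u B
  optimal B′ B′-bases = ≤-trans (weak-duality u B′ M (proj₁ ∘ B′-bases) L) dual≤value

  dual-optimal : ∀ S → k * rank L + weight u (∁ L) ≤ k * rank S + weight u (∁ S)
  dual-optimal S = ≤-trans dual≤value (weak-duality u B M (proj₁ ∘ bases) S)
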